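{- For every temporal graph $\mathcal{G}=(V,E)$, all $s,z\in V$ and all $x,\delta\in\mathbb{N}$, the instance $(\mathcal{G},s,z,x,\delta)$ is a yes-instance of Traversal-Delay-Robust Path if and only if it is a yes-instance of Starting-Delay-Robust Path.
   Context: A temporal graph $\mathcal{G}=(V,E)$ consists of a finite vertex set $V$ and a finite set $E$ of time arcs $e=(v,w,t,\lambda)$ with start vertex $v$, end vertex $w$, time label $t\in\mathbb{N}$ and traversal time $\lambda\in\mathbb{N}$. A temporal walk is a sequence of time arcs $(v_i,w_i,t_i,\lambda_i)_{i=1}^{\ell}$ with $v_{i+1}=w_i$ and $t_{i+1}\ge t_i+\lambda_i$ for all $i<\ell$. For $D\subseteq E$ and $\delta\in\mathbb{N}$: a starting delay on an arc increases its time label by $\delta$; a traversal delay increases its traversal time by $\delta$. A sequence of time arcs is a $D$-starting-delayed (resp. $D$-traversal-delayed) temporal walk if it is a temporal walk in the temporal graph obtained from $\mathcal{G}$ by applying starting (resp. traversal) delays to all arcs of $D$. A route is a sequence of vertices $R$; a (delayed) temporal walk follows $R$ if the vertices it visits ($v_1,w_1,\dots,w_\ell$) are exactly $R$ in order; $R$ is a $D$-delayed route if a $D$-delayed temporal walk follows it. An $(s,z)$-route starts at $s$ and ends at $z$. A route is $x$-traversal-delay-robust (resp. $x$-starting-delay-robust) if it is a $D$-traversal-delayed (resp. $D$-starting-delayed) route for all $D\subseteq E$ with $|D|\le x$. Traversal-Delay-Robust Path (resp. Starting-Delay-Robust Path): given $(\mathcal{G},s,z,x,\delta)$, decide whether there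 is an $x$-traversal-delay-robust (resp. $x$-starting-delay-robust) $(s,z)$-route in $\mathcal{G}$. -}

module Defs where

open import Data.Nat using (ℕ; _+_; _≤_)
open import Data.Nat.Properties as ℕP using ()
open import Data.Fin using (Fin)
open import Data.Fin.Properties as FinP using ()
open import Data.List using (List; []; _∷_; map; length)
open import Data.List.Membership.Propositional using (_∈_)
open import Data.List.Relation.Unary.Unique.Propositional using (Unique)
open import Data.List.Relation.Unary.All using (All)
open import Data.Product using (_×_; _,_; ∃; Σ)
open import Relation.Binary.PropositionalEquality using (_≡_)
open import Relation.Binary.Definitions using (DecidableEquality)
open import Relation.Nullary using (yes; no)
open import Data.Product.Properties using (≡-dec)
import Data.List.Membership.DecPropositional as DecMem

record Arc (n : ℕ) : Set where
  constructor arc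
  field
    start : Fin n
    end   : Fin n
    label : ℕ
    trav  : ℕ
open Arc public

record TemporalGraph (n : ℕ) : Set where
  constructor tgraph
  field
    arcs   : List (Arc n)
    unique : Unique arcs
open TemporalGraph public

_≟A_ : ∀ {n} → DecidableEquality (Arc n)
arc v w t l ≟A arc v′ w′ t′ l′ with v FinP.≟ v′ | w FinP.≟ w′ | t ℕP.≟ t′ | l ℕP.≟ l′
... | yes Relation.Binary.PropositionalEquality.refl | yes Relation.Binary.PropositionalEquality.refl | yes Relation.Binary.PropositionalEquality.refl | yes Relation.Binary.PropositionalEquality.refl = yes Relation.Binary.PropositionalEquality.refl
... | no ¬p | _ | _ | _ = no λ { Relation.Binary.PropositionalEquality.refl → ¬p Relation.Binary.PropositionalEquality.refl }
... | yes _ | no ¬p | _ | _ = no λ { Relation.Binary.PropositionalEquality.refl → ¬p Relation.Binary.PropositionalEquality.refl }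
... | yes _ | yes _ | no ¬p | _ = no λ { Relation.Binary.PropositionalEquality.refl → ¬p Relation.Binary.PropositionalEquality.refl }
... | yes _ | yes _ | yes _ | no ¬p = no λ { Relation.Binary.PropositionalEquality.refl → ¬p Relation.Binary.PropositionalEquality.refl }

data IsTemporalWalk {n : ℕ} : List (Arc n) → Set where
  single : ∀ e → IsTemporalWalk (e ∷ [])
  cons   : ∀ e f es →
           start f ≡ end e →
           label e + trav e ≤ label f →
           IsTemporalWalk (f ∷ es) →
           IsTemporalWalk (e ∷ f ∷ es)

visited : ∀ {n} → List (Arc n) → List (Fin n)
visited []       = []
visited (e ∷ es) = start e ∷ map end (e ∷ es)

startDelay : ∀ {n} → ℕ → Arc n → Arc n
startDelay δ (arc v w t l) = arc v w (t + δ) l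

travDelay : ∀ {n} → ℕ → Arc n → Arc n
travDelay δ (arc v w t l) = arc v w t (l + δ)

applyDelay : ∀ {n} → (ℕ → Arc n → Arc n) → ℕ → List (Arc n) → Arc n → Arc n
applyDelay f δ D e with DecMem._∈?_ _≟A_ e D
... | yes _ = f δ e
... | no  _ = e

delayedArcs : ∀ {n} → (ℕ → Arc n → Arc n) → TemporalGraph n → List (Arc n) → ℕ → List (Arc n)
delayedArcs f G D δ = map (applyDelay f δ D) (arcs G)

WalkFollowing : ∀ {n} → List (Arc n) → List (Fin n) → Set
WalkFollowing {n} A R =
  Σ (List (Arc n)) λ W → All (_∈ A) W × IsTemporalWalk W × visited W ≡ R

DelayedRoute : ∀ {n} → (ℕ → Arc n → Arc n) → TemporalGraph n → ℕ → List (Arc n) → List (Fin n) → Set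
DelayedRoute f G δ D R = WalkFollowing (delayedArcs f G D δ) R

Robust : ∀ {n} → (ℕ → Arc n → Arc n) → TemporalGraph n → ℕ → ℕ → List (Fin n) → Set
Robust f G x δ R =
  (D : List (Arc _)) → All (_∈ arcs G) D → Unique D → length D ≤ x → DelayedRoute f G δ D R

IsSZRoute : ∀ {n} → Fin n → Fin n → List (Fin n) → Set
IsSZRoute s z R = Σ (List _) λ M → (R ≡ s ∷ M) × Σ (List _) λ P → R ≡ Data.List._++_ P (z ∷ [])

TraversalDelayRobustPath : ∀ {n} → TemporalGraph n → Fin n → Fin n → ℕ → ℕ → Set
TraversalDelayRobustPath G s z x δ =
  ∃ λ R → IsSZRoute s z R × Robust travDelay G x δ R

StartingDelayRobustPath : ∀ {n} → TemporalGraph n → Fin n → Fin n → ℕ → ℕ → Set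
StartingDelayRobustPath G s z x δ =
  ∃ λ R → IsSZRoute s z R × Robust startDelay G x δ R

-- A starting-delayed arc departs no earlier than the traversal-delayed arc and
-- arrives at the same time, so every traversal-delayed walk is also a
-- starting-delayed walk, and traversal-robust routes are starting-robust.
--
-- Conversely, let R be starting-robust; we may assume no step (v , w) occurs
-- twice in R, since shortcutting a repeated step keeps R followable.  Given a
-- delay set D, follow R greedily: from v at time T take, among the arcs v → w
-- leaving no earlier than T, one with the earliest traversal-delayed arrival.
-- For a subset q of D, delay the arcs v → w as in D restricted to these
-- candidates and the other arcs as in q.  A starting-delayed walk for this set
-- (which exists by robustness) starts with a candidate, whose starting-delayed
-- arrival equals its traversal-delayed arrival and so is no earlier than the
-- greedy one.  The remaining steps avoid the arcs v → w, so the rest of that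
-- walk shows that the rest of R is starting-robust against every subset of D
-- from the greedy arrival time on.

module Submission where

open import Defs
open import Data.Bool using (Bool; true; false; T; if_then_else_)
open import Data.Empty using (⊥-elim)
open import Data.Fin using (Fin)
import Data.Fin.Properties as Fin
open import Data.List using (List; []; _∷_; _++_; map; filter)
open import Data.List.Properties using (∷-injectiveˡ; ∷-injectiveʳ; map-cong; length-filter)
open import Data.List.Extrema.Nat using (argmin; argmin-sel; f[argmin]≤f[xs])
open import Data.List.Membership.Propositional using (_∈_)
open import Data.List.Membership.Propositional.Properties using (∈-map⁺; ∈-map⁻; ∈-filter⁺; ∈-filter⁻)
import Data.List.Membership.DecPropositional as DecMembership
open import Data.List.Relation.Unary.All using (All; []; _∷_; lookup)
open import Data.List.Relation.Unary.All.Properties using (¬Any⇒All¬; All¬⇒¬Any)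
import Data.List.Relation.Unary.All.Properties as All
open import Data.List.Relation.Unary.Any using (here; there)
open import Data.List.Relation.Unary.Unique.Propositional using (Unique; []; _∷_)
import Data.List.Relation.Unary.Unique.Propositional.Properties as Unique
open import Data.Nat using (ℕ; _+_; _≤_; _≤?_; z≤n)
open import Data.Nat.Properties using (≤-refl; ≤-trans; m≤m+n; +-assoc; +-comm)
open import Data.Product using (_×_; _,_; ∃; ∃₂; Σ; proj₁; proj₂)
open import Data.Product.Properties using (≡-dec)
open import Data.Sum using (inj₁; inj₂)
open import Data.Unit using (tt)
open import Function using (_∘_)
open import Relation.Binary.PropositionalEquality
open import Relation.Nullary using (Dec; yes; no; ¬_; does)
open import Relation.Nullary.Decidable using (_×-dec_; T?)
open import Relation.Unary using (Decidable)

steps : ∀ {n} → List (Fin n) → List (Fin n × Fin n)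
steps []          = []
steps (v ∷ [])    = []
steps (v ∷ w ∷ R) = (v , w) ∷ steps (w ∷ R)

DistinctSteps : ∀ {n} → List (Fin n) → Set
DistinctSteps R = Unique (steps R)

EndsIn : ∀ {n} → Fin n → List (Fin n) → Set
EndsIn z R = ∃ λ P → R ≡ P ++ z ∷ []

data Suffix {n : ℕ} : List (Fin n) → List (Fin n) → Set where
  self : ∀ {L} → Suffix L L
  drop : ∀ {v S L} → Suffix S L → Suffix S (v ∷ L)

∈-steps⇒Suffix : ∀ {n} {a b : Fin n} L → (a , b) ∈ steps L → ∃ λ R → Suffix (a ∷ b ∷ R) L
∈-steps⇒Suffix (v ∷ w ∷ L) (here refl) = L , self
∈-steps⇒Suffix (v ∷ w ∷ L) (there m) with ∈-steps⇒Suffix (w ∷ L) m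
... | R , s = R , drop s

DistinctSteps-tail : ∀ {n} {v : Fin n} {L} → DistinctSteps (v ∷ L) → DistinctSteps L
DistinctSteps-tail {L = []}    _              = []
DistinctSteps-tail {L = w ∷ L} (_ ∷ distinct) = distinct

DistinctSteps-suffix : ∀ {n} {S L : List (Fin n)} → Suffix S L → DistinctSteps L → DistinctSteps S
DistinctSteps-suffix self     distinct = distinct
DistinctSteps-suffix (drop s) distinct = DistinctSteps-suffix s (DistinctSteps-tail distinct)

EndsIn-∷ : ∀ {n} {v z : Fin n} {L} → EndsIn z L → EndsIn z (v ∷ L)
EndsIn-∷ {v = v} (P , eq) = v ∷ P , cong (v ∷_) eq

EndsIn-tail : ∀ {n} {v w z : Fin n} {L} → EndsIn z (v ∷ w ∷ L) → EndsIn z (w ∷ L)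
EndsIn-tail ([]    , ())
EndsIn-tail (_ ∷ P , eq) = P , ∷-injectiveʳ eq

EndsIn-suffix : ∀ {n} {a z : Fin n} {S L} → Suffix (a ∷ S) L → EndsIn z L → EndsIn z (a ∷ S)
EndsIn-suffix self                          ends = ends
EndsIn-suffix {L = _ ∷ []}    (drop ())
EndsIn-suffix {L = _ ∷ _ ∷ _} (drop s)      ends = EndsIn-suffix s (EndsIn-tail ends)

WalkFollowing-nontrivial : ∀ {n} {B : List (Arc n)} {R} → WalkFollowing B R →
  ∃₂ λ v w → ∃ λ R′ → R ≡ v ∷ w ∷ R′
WalkFollowing-nontrivial (e ∷ es , _ , _ , visited≡) = start e , end e , map end es , sym visited≡

DelaySet : ℕ → Set
DelaySet n = Arc n → Bool

_⊑_ : ∀ {n} → DelaySet n → DelaySet n → Set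
d ⊑ d′ = ∀ {e} → T (d e) → T (d′ e)

delayOn : ∀ {n} → (ℕ → Arc n → Arc n) → ℕ → DelaySet n → Arc n → Arc n
delayOn f δ d e = if d e then f δ e else e

delayOn-cong : ∀ {n} f δ {d d′ : DelaySet n} {e} → d e ≡ d′ e → delayOn f δ d e ≡ delayOn f δ d′ e
delayOn-cong f δ {e = e} = cong (λ b → if b then f δ e else e)

memberOf : ∀ {n} → List (Arc n) → DelaySet n
memberOf D e = does (DecMembership._∈?_ _≟A_ e D)

applyDelay≗delayOn : ∀ {n} f δ (D : List (Arc n)) e → applyDelay f δ D e ≡ delayOn f δ (memberOf D) e
applyDelay≗delayOn f δ D e with DecMembership._∈?_ _≟A_ e D
... | yes _ = refl
... | no  _ = refl

T-injective : ∀ {a b} → (T a → T b) → (T b → T a) → a ≡ b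
T-injective {false} {false} _ _ = refl
T-injective {false} {true}  _ f = ⊥-elim (f tt)
T-injective {true}  {false} f _ = ⊥-elim (f tt)
T-injective {true}  {true}  _ _ = refl

memberOf⁻ : ∀ {n} {D : List (Arc n)} {e} → T (memberOf D e) → e ∈ D
memberOf⁻ {D = D} {e} with DecMembership._∈?_ _≟A_ e D
... | yes e∈D = λ _ → e∈D
... | no  _   = λ ()

memberOf⁺ : ∀ {n} {D : List (Arc n)} {e} → e ∈ D → T (memberOf D e)
memberOf⁺ {D = D} {e} with DecMembership._∈?_ _≟A_ e D
... | yes _   = λ _ → tt
... | no  e∉D = e∉D

memberOf-filter : ∀ {n} {q : DelaySet n} {D} → q ⊑ memberOf D → ∀ e → memberOf (filter (T? ∘ q) D) e ≡ q e
memberOf-filter {q = q} {D} q⊑D e =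
  T-injective (proj₂ ∘ ∈-filter⁻ (T? ∘ q) {xs = D} ∘ memberOf⁻ {D = filter (T? ∘ q) D})
              (λ qe → memberOf⁺ (∈-filter⁺ (T? ∘ q) (memberOf⁻ {D = D} (q⊑D qe)) qe))

arrival : ∀ {n} → (Arc n → Arc n) → Arc n → ℕ
arrival g e = label (g e) + trav (g e)

label-travDelay : ∀ {n} δ (d : DelaySet n) e → label (delayOn travDelay δ d e) ≡ label e
label-travDelay δ d e with d e
... | true  = refl
... | false = refl

label≤label-startDelay : ∀ {n} δ (d : DelaySet n) e → label e ≤ label (delayOn startDelay δ d e)
label≤label-startDelay δ d e with d e
... | true  = m≤m+n (label e) δ
... | false = ≤-refl

arrival-startDelay≡travDelay : ∀ {n} δ (d : DelaySet n) e →
  arrival (delayOn startDelay δ d) e ≡ arrival (delayOn travDelay δ d) e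
arrival-startDelay≡travDelay δ d (arc v w t l) with d (arc v w t l)
... | true  = trans (+-assoc t δ l) (cong (t +_) (+-comm δ l))
... | false = refl

arrival-cong : ∀ {n} (g g′ : Arc n → Arc n) {e} → g e ≡ g′ e → arrival g e ≡ arrival g′ e
arrival-cong g g′ = cong (λ a → label a + trav a)

PreservesEndpoints : ∀ {n} → (Arc n → Arc n) → Set
PreservesEndpoints g = ∀ e → start (g e) ≡ start e × end (g e) ≡ end e

delayOn-preservesEndpoints : ∀ {n} (f : ℕ → Arc n → Arc n) δ →
  PreservesEndpoints (f δ) → ∀ d → PreservesEndpoints (delayOn f δ d)
delayOn-preservesEndpoints f δ preserves d e with d e
... | true  = preserves e
... | false = refl , refl

startDelay-preservesEndpoints : ∀ {n} δ → PreservesEndpoints (startDelay {n} δ)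
startDelay-preservesEndpoints δ (arc _ _ _ _) = refl , refl

travDelay-preservesEndpoints : ∀ {n} δ → PreservesEndpoints (travDelay {n} δ)
travDelay-preservesEndpoints δ (arc _ _ _ _) = refl , refl

∃-minimiser : ∀ {X : Set} {P : X → Set} → Decidable P → (f : X → ℕ) → ∀ {x xs} → x ∈ xs → P x →
  ∃ λ y → y ∈ xs × P y × (∀ {c} → c ∈ xs → P c → f y ≤ f c)
∃-minimiser {P = P} P? f {x} {xs} x∈xs px = y , proj₁ chosen , proj₂ chosen , minimal
  where
  ys = filter P? xs
  y  = argmin f x ys
  chosen : y ∈ xs × P y
  chosen with argmin-sel f x ys
  ... | inj₁ y≡x  = subst (λ c → c ∈ xs × P c) (sym y≡x) (x∈xs , px)
  ... | inj₂ y∈ys = ∈-filter⁻ P? y∈ys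
  minimal : ∀ {c} → c ∈ xs → P c → f y ≤ f c
  minimal c∈xs pc = lookup (f[argmin]≤f[xs] {f = f} x ys) (∈-filter⁺ P? c∈xs pc)

module _ {n : ℕ} (A : List (Arc n)) where

  -- R can be followed by arcs e of A, each acting as g e, leaving the first
  -- vertex of R no earlier than T.
  data Followable (g : Arc n → Arc n) : List (Fin n) → ℕ → Set where
    stop : ∀ {v T} → Followable g (v ∷ []) T
    step : ∀ {v w R T} e → e ∈ A → start e ≡ v → end e ≡ w → T ≤ label (g e) →
           Followable g (w ∷ R) (arrival g e) → Followable g (v ∷ w ∷ R) T

  Followable-≤ : ∀ {g R T T′} → T′ ≤ T → Followable g R T → Followable g R T′
  Followable-≤ T′≤T stop                      = stop
  Followable-≤ T′≤T (step e e∈A se ee T≤ rest) = step e e∈A se ee (≤-trans T′≤T T≤) rest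

  Followable-tail : ∀ {g v w R T} → Followable g (v ∷ w ∷ R) T → Followable g (w ∷ R) T
  Followable-tail (step e _ _ _ T≤ rest) = Followable-≤ (≤-trans T≤ (m≤m+n _ _)) rest

  Followable-suffix : ∀ {g a S L T} → Suffix (a ∷ S) L → Followable g L T → Followable g (a ∷ S) T
  Followable-suffix self                       F = F
  Followable-suffix {L = _ ∷ []}    (drop ())
  Followable-suffix {L = _ ∷ _ ∷ _} (drop s) F = Followable-suffix s (Followable-tail F)

  Followable-cong : ∀ {g g′ R T} → (∀ e → (start e , end e) ∈ steps R → g e ≡ g′ e) →
    Followable g R T → Followable g′ R T
  Followable-cong g≡g′ stop = stop
  Followable-cong {g} {g′} {T = T} g≡g′ (step e e∈A refl refl T≤ rest) =
    step e e∈A refl refl (subst (λ a → T ≤ label a) g≡g′ₑ T≤)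
      (subst (Followable g′ _) (arrival-cong g g′ g≡g′ₑ)
        (Followable-cong (λ a → g≡g′ a ∘ there) rest))
    where
    g≡g′ₑ : g e ≡ g′ e
    g≡g′ₑ = g≡g′ e (here refl)

  walk⇒Followable : ∀ {g e es} → PreservesEndpoints g → IsTemporalWalk (e ∷ es) →
    All (_∈ map g A) (e ∷ es) → Followable g (visited (e ∷ es)) (label e)
  walk⇒Followable preserves (single _) (e∈ ∷ []) with ∈-map⁻ _ e∈
  ... | a , a∈A , refl = step a a∈A (sym (proj₁ (preserves a))) (sym (proj₂ (preserves a))) ≤-refl stop
  walk⇒Followable {g} preserves (cons _ f es f-after-e e-before-f W) (e∈ ∷ W∈) with ∈-map⁻ _ e∈
  ... | a , a∈A , refl =
    step a a∈A (sym (proj₁ (preserves a))) (sym (proj₂ (preserves a))) ≤-refl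
      (subst (λ v → Followable g (v ∷ map end (f ∷ es)) (arrival g a)) f-after-e
        (Followable-≤ e-before-f (walk⇒Followable preserves W W∈)))

  Followable⇒walk : ∀ {g v w R T} → PreservesEndpoints g → Followable g (v ∷ w ∷ R) T →
    Σ (Arc n) λ e → Σ (List (Arc n)) λ es → T ≤ label e ×
      All (_∈ map g A) (e ∷ es) × IsTemporalWalk (e ∷ es) × visited (e ∷ es) ≡ v ∷ w ∷ R
  Followable⇒walk {g} {R = []} preserves (step a a∈A sa ea T≤ stop) =
    g a , [] , T≤ , ∈-map⁺ g a∈A ∷ [] , single (g a) ,
    cong₂ (λ v w → v ∷ w ∷ []) (trans (proj₁ (preserves a)) sa) (trans (proj₂ (preserves a)) ea)
  Followable⇒walk {g} {R = _ ∷ _} preserves (step a a∈A sa ea T≤ rest)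
    with Followable⇒walk preserves rest
  ... | f , fs , a-before-f , W∈ , W , visited≡ =
    g a , f ∷ fs , T≤ , ∈-map⁺ g a∈A ∷ W∈ ,
    cons (g a) f fs (trans (∷-injectiveˡ visited≡) (sym (trans (proj₂ (preserves a)) ea))) a-before-f W ,
    cong₂ _∷_ (trans (proj₁ (preserves a)) sa) (cong₂ _∷_ (trans (proj₂ (preserves a)) ea) (∷-injectiveʳ visited≡))

  WalkFollowing⇒Followable : ∀ {g R} → PreservesEndpoints g → WalkFollowing (map g A) R → Followable g R 0
  WalkFollowing⇒Followable preserves (e ∷ es , W∈ , W , refl) =
    Followable-≤ z≤n (walk⇒Followable preserves W W∈)

  Followable⇒WalkFollowing : ∀ {g v w R T} → PreservesEndpoints g → Followable g (v ∷ w ∷ R) T →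
    WalkFollowing (map g A) (v ∷ w ∷ R)
  Followable⇒WalkFollowing preserves F with Followable⇒walk preserves F
  ... | e , es , _ , W∈ , W , visited≡ = e ∷ es , W∈ , W , visited≡

  record StepSimplification (v w : Fin n) (R : List (Fin n)) : Set where
    field
      rest       : List (Fin n)
      distinct   : DistinctSteps (v ∷ w ∷ rest)
      followable : ∀ {g T} → Followable g (v ∷ w ∷ R) T → Followable g (v ∷ w ∷ rest) T
      endsIn     : ∀ {z} → EndsIn z (v ∷ w ∷ R) → EndsIn z (v ∷ w ∷ rest)

  simplifySteps : ∀ v w R → StepSimplification v w R
  simplifySteps v w [] = record
    { rest = [] ; distinct = [] ∷ [] ; followable = λ F → F ; endsIn = λ ends → ends }
  simplifySteps v w (x ∷ R) = shortcut (DecMembership._∈?_ (≡-dec Fin._≟_ Fin._≟_) (v , w) (steps tail))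
    where
    open StepSimplification (simplifySteps w x R) using () renaming
      (rest to rest′; distinct to distinct′; followable to followable′; endsIn to endsIn′)

    tail : List (Fin n)
    tail = w ∷ x ∷ rest′

    followable-∷ : ∀ {g T} → Followable g (v ∷ w ∷ x ∷ R) T → Followable g (v ∷ tail) T
    followable-∷ (step e e∈A se ee T≤ F) = step e e∈A se ee T≤ (followable′ F)

    endsIn-∷ : ∀ {z} → EndsIn z (v ∷ w ∷ x ∷ R) → EndsIn z (v ∷ tail)
    endsIn-∷ = EndsIn-∷ ∘ endsIn′ ∘ EndsIn-tail

    shortcut : Dec ((v , w) ∈ steps tail) → StepSimplification v w (x ∷ R)
    shortcut (no fresh) = record
      { rest = x ∷ rest′ ; distinct = ¬Any⇒All¬ _ fresh ∷ distinct′
      ; followable = followable-∷ ; endsIn = endsIn-∷ }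
    shortcut (yes later) with ∈-steps⇒Suffix tail later
    ... | r , s = record
      { rest = r ; distinct = DistinctSteps-suffix s distinct′
      ; followable = Followable-suffix (drop s) ∘ followable-∷
      ; endsIn = EndsIn-suffix (drop s) ∘ endsIn-∷ }

module _ {n : ℕ} (A : List (Arc n)) (δ : ℕ) where

  traversal⇒starting : ∀ d {R T} → Followable A (delayOn travDelay δ d) R T → Followable A (delayOn startDelay δ d) R T
  traversal⇒starting d stop = stop
  traversal⇒starting d {T = T} (step e e∈A se ee T≤ F) =
    step e e∈A se ee (≤-trans (subst (T ≤_) (label-travDelay δ d e) T≤) (label≤label-startDelay δ d e))
      (subst (Followable A _ _) (sym (arrival-startDelay≡travDelay δ d e)) (traversal⇒starting d F))

  IsStep : Fin n → Fin n → Arc n → Set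
  IsStep v w e = start e ≡ v × end e ≡ w

  isStep? : ∀ v w → Decidable (IsStep v w)
  isStep? v w e = (start e Fin.≟ v) ×-dec (end e Fin.≟ w)

  Candidate : Fin n → Fin n → ℕ → Arc n → Set
  Candidate v w T e = IsStep v w e × T ≤ label e

  candidate? : ∀ v w T → Decidable (Candidate v w T)
  candidate? v w T e = isStep? v w e ×-dec (T ≤? label e)

  module _ (v w : Fin n) (T : ℕ) (d : DelaySet n) where

    focus : DelaySet n → DelaySet n
    focus q e with isStep? v w e | T ≤? label e
    ... | yes _ | yes _ = d e
    ... | yes _ | no  _ = false
    ... | no  _ | _     = q e

    focus-⊑ : ∀ q → q ⊑ d → focus q ⊑ d
    focus-⊑ q q⊑d {e} with isStep? v w e | T ≤? label e
    ... | yes _ | yes _ = λ de → de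
    ... | yes _ | no  _ = λ ()
    ... | no  _ | _     = q⊑d

    focus-candidate : ∀ q e → IsStep v w e → T ≤ label (delayOn startDelay δ (focus q) e) →
      Candidate v w T e × focus q e ≡ d e
    focus-candidate q e isStep with isStep? v w e | T ≤? label e
    ... | yes _    | yes T≤e = λ _ → (isStep , T≤e) , refl
    ... | yes _    | no  T≰e = λ T≤e → ⊥-elim (T≰e T≤e)
    ... | no ¬step | _       = ⊥-elim (¬step isStep)

    focus-off : ∀ q e → ¬ IsStep v w e → focus q e ≡ q e
    focus-off q e ¬step with isStep? v w e | T ≤? label e
    ... | yes isStep | _ = ⊥-elim (¬step isStep)
    ... | no  _      | _ = refl

    focus-agrees : ∀ q {R} → ¬ (v , w) ∈ steps R → ∀ e → (start e , end e) ∈ steps R →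
      delayOn startDelay δ (focus q) e ≡ delayOn startDelay δ q e
    focus-agrees q {R} fresh e e∈R = delayOn-cong startDelay δ {focus q} {q} (focus-off q e λ (sv , ew) →
      fresh (subst (_∈ steps R) (cong₂ _,_ sv ew) e∈R))

    focused-first-step : ∀ q {R} → Followable A (delayOn startDelay δ (focus q)) (v ∷ w ∷ R) T →
      ∃ λ c → c ∈ A × Candidate v w T c ×
        Followable A (delayOn startDelay δ (focus q)) (w ∷ R) (arrival (delayOn travDelay δ d) c)
    focused-first-step q (step c c∈A sc ec T≤c F) =
      c , c∈A , candidate , subst (Followable A _ _) arrival≡ F
      where
      candidate : Candidate v w T c
      candidate = proj₁ (focus-candidate q c (sc , ec) T≤c)
      focus≡d : focus q c ≡ d c
      focus≡d = proj₂ (focus-candidate q c (sc , ec) T≤c)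
      arrival≡ : arrival (delayOn startDelay δ (focus q)) c ≡ arrival (delayOn travDelay δ d) c
      arrival≡ = begin
        arrival (delayOn startDelay δ (focus q)) c
          ≡⟨ arrival-cong (delayOn startDelay δ (focus q)) (delayOn startDelay δ d) (delayOn-cong startDelay δ {focus q} {d} focus≡d) ⟩
        arrival (delayOn startDelay δ d) c         ≡⟨ arrival-startDelay≡travDelay δ d c ⟩
        arrival (delayOn travDelay δ d) c          ∎
        where open ≡-Reasoning using (begin_; step-≡-⟩; _∎)

  starting-robust⇒traversal : ∀ {v R} → DistinctSteps (v ∷ R) → ∀ T d →
    (∀ q → q ⊑ d → Followable A (delayOn startDelay δ q) (v ∷ R) T) →
    Followable A (delayOn travDelay δ d) (v ∷ R) T
  starting-robust⇒traversal {R = []} _ _ _ _ = stop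
  starting-robust⇒traversal {v} {w ∷ R} (fresh ∷ distinct) T d robust =
    let c₀ , c₀∈A , c₀-candidate , _ = first d (λ de → de)
        e , e∈A , ((se , ee) , T≤e) , earliest =
          ∃-minimiser (candidate? v w T) (arrival (delayOn travDelay δ d)) c₀∈A c₀-candidate
        later : ∀ q → q ⊑ d → Followable A (delayOn startDelay δ q) (w ∷ R) (arrival (delayOn travDelay δ d) e)
        later q q⊑d =
          let c , c∈A , c-candidate , F = first q q⊑d
          in Followable-cong A (focus-agrees v w T d q (All¬⇒¬Any fresh)) (Followable-≤ A (earliest c∈A c-candidate) F)
    in step e e∈A se ee (subst (T ≤_) (sym (label-travDelay δ d e)) T≤e)
         (starting-robust⇒traversal distinct (arrival (delayOn travDelay δ d) e) d later)
    where
    first : ∀ q → q ⊑ d → ∃ λ c → c ∈ A × Candidate v w T c ×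
      Followable A (delayOn startDelay δ (focus v w T d q)) (w ∷ R) (arrival (delayOn travDelay δ d) c)
    first q q⊑d = focused-first-step v w T d q (robust (focus v w T d q) (focus-⊑ v w T d q q⊑d))

module _ {n : ℕ} (G : TemporalGraph n) (δ : ℕ) where

  delayedArcs≡map-delayOn : ∀ f D → delayedArcs f G D δ ≡ map (delayOn f δ (memberOf D)) (arcs G)
  delayedArcs≡map-delayOn f D = map-cong (applyDelay≗delayOn f δ D) (arcs G)

  DelayedRoute⇒Followable : ∀ f → PreservesEndpoints (f δ) → ∀ D {R} →
    DelayedRoute f G δ D R → Followable (arcs G) (delayOn f δ (memberOf D)) R 0
  DelayedRoute⇒Followable f preserves D W =
    WalkFollowing⇒Followable (arcs G) (delayOn-preservesEndpoints f δ preserves (memberOf D))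
      (subst (λ B → WalkFollowing B _) (delayedArcs≡map-delayOn f D) W)

  Followable⇒DelayedRoute : ∀ f → PreservesEndpoints (f δ) → ∀ D {v w R T} →
    Followable (arcs G) (delayOn f δ (memberOf D)) (v ∷ w ∷ R) T → DelayedRoute f G δ D (v ∷ w ∷ R)
  Followable⇒DelayedRoute f preserves D F =
    subst (λ B → WalkFollowing B _) (sym (delayedArcs≡map-delayOn f D))
      (Followable⇒WalkFollowing (arcs G) (delayOn-preservesEndpoints f δ preserves (memberOf D)) F)

  traversal-robust⇒starting-robust : ∀ {x R} → Robust travDelay G x δ R → Robust startDelay G x δ R
  traversal-robust⇒starting-robust robust D D⊆E unique |D|≤x
    with W ← robust D D⊆E unique |D|≤x | WalkFollowing-nontrivial W
  ... | _ , _ , _ , refl =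
    Followable⇒DelayedRoute startDelay (startDelay-preservesEndpoints δ) D
      (traversal⇒starting (arcs G) δ (memberOf D)
        (DelayedRoute⇒Followable travDelay (travDelay-preservesEndpoints δ) D W))

  Robust-shortcut : ∀ f {x v w R R′} → PreservesEndpoints (f δ) →
    (∀ {g T} → Followable (arcs G) g (v ∷ w ∷ R) T → Followable (arcs G) g (v ∷ w ∷ R′) T) →
    Robust f G x δ (v ∷ w ∷ R) → Robust f G x δ (v ∷ w ∷ R′)
  Robust-shortcut f preserves shortcut robust D D⊆E unique |D|≤x =
    Followable⇒DelayedRoute f preserves D
      (shortcut (DelayedRoute⇒Followable f preserves D (robust D D⊆E unique |D|≤x)))

  starting-robust⇒traversal-robust : ∀ {x v w R} → DistinctSteps (v ∷ w ∷ R) →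
    Robust startDelay G x δ (v ∷ w ∷ R) → Robust travDelay G x δ (v ∷ w ∷ R)
  starting-robust⇒traversal-robust distinct robust D D⊆E unique |D|≤x =
    Followable⇒DelayedRoute travDelay (travDelay-preservesEndpoints δ) D
      (starting-robust⇒traversal (arcs G) δ distinct 0 (memberOf D) λ q q⊑D →
        Followable-cong (arcs G) (λ e _ → delayOn-cong startDelay δ {memberOf (Dq q)} {q} (memberOf-filter {D = D} q⊑D e))
          (DelayedRoute⇒Followable startDelay (startDelay-preservesEndpoints δ) (Dq q)
            (robust (Dq q) (All.filter⁺ (T? ∘ q) D⊆E) (Unique.filter⁺ (T? ∘ q) unique)
                    (≤-trans (length-filter (T? ∘ q) D) |D|≤x))))
    where
    Dq : DelaySet n → List (Arc n)
    Dq q = filter (T? ∘ q) D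

  traversalDelayRobustPath⇒starting : ∀ {s z x} → TraversalDelayRobustPath G s z x δ → StartingDelayRobustPath G s z x δ
  traversalDelayRobustPath⇒starting (R , szRoute , robust) = R , szRoute , traversal-robust⇒starting-robust robust

  startingDelayRobustPath⇒traversal : ∀ {s z x} → StartingDelayRobustPath G s z x δ → TraversalDelayRobustPath G s z x δ
  startingDelayRobustPath⇒traversal (R , (M , R≡sM , ends) , robust)
    with WalkFollowing-nontrivial (robust [] [] [] z≤n)
  ... | v , w , R′ , refl =
    v ∷ w ∷ rest , (w ∷ rest , cong (λ u → u ∷ w ∷ rest) (∷-injectiveˡ R≡sM) , endsIn ends) ,
    starting-robust⇒traversal-robust distinct (Robust-shortcut startDelay (startDelay-preservesEndpoints δ) followable robust)
    where open StepSimplification (simplifySteps (arcs G) v w R′)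

theorem4 : (n : ℕ) (G : TemporalGraph n) (s z : Fin n) (x δ : ℕ) →
    (TraversalDelayRobustPath G s z x δ → StartingDelayRobustPath G s z x δ) ×
    (StartingDelayRobustPath G s z x δ → TraversalDelayRobustPath G s z x δ)
theorem4 n G s z x δ = traversalDelayRobustPath⇒starting G δ , startingDelayRobustPath⇒traversal G δ
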